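{- Let $p_k$ denote the $k$-th prime ($p_1=2,p_2=3,\ldots$) and define $s_n=\sum_{k=1}^n(-1)^{n-k}p_k$ for all $n\in\mathbb{Z}^+$. Then for any $n\in\mathbb{Z}^+$, the numbers $2s_k^2$ $(k=1,\ldots,n)$ are pairwise distinct modulo $p_{n+1}$.
   Context: $\mathbb{Z}^+=\{1,2,3,\ldots\}$. -}

module Defs where

open import Data.Nat using (ℕ; zero; suc; _+_; _!)
open import Data.Nat.Primality using (prime?)
open import Data.Integer using (ℤ; +_; -_)
open import Relation.Nullary using (yes; no)

-- Search for the least prime among m, m+1, ..., m+fuel-1 (returns m+fuel on failure).
searchPrime : ℕ → ℕ → ℕ
searchPrime zero    m = m
searchPrime (suc f) m with prime? m
... | yes _ = m
... | no  _ = searchPrime f (suc m)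

-- least prime > n; by Euclid there is one in (n, n!+1], so fuel n! + 1 suffices.
nextPrime : ℕ → ℕ
nextPrime n = searchPrime (n ! + 1) (suc n)

-- p k = the k-th prime, 1-indexed: p 1 = 2, p 2 = 3, ...
-- (p 0 = 1 is a dummy value, never used by the theorem.)
p : ℕ → ℕ
p zero    = 1
p (suc k) = nextPrime (p k)

-- s n = Σ_{k=1}^n (-1)^(n-k) p_k, via s 0 = 0, s (n+1) = p (n+1) - s n.
s : ℕ → ℤ
s zero    = + 0
s (suc n) = Data.Integer._-_ (+ p (suc n)) (s n)

-- Write t k for the natural number with s k = + t k, so that
-- t (k+1) + t k = p (k+1), t k ≤ p k, and t (k+2) > t k (because p is
-- increasing).  Since every prime after 2 is odd, t (k+1) has the parity
-- of k.  Hence t is strictly increasing on each parity class of indices,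
-- and is injective on positive indices.
--
-- Let q = p (m+2), 1 ≤ i ≠ j ≤ m+1, a = t i, b = t j.  If q divided
-- 2a² − 2b² = 2 ∣a − b∣ (a + b), then q would divide one factor.  But q > 2;
-- 0 < ∣a − b∣ < q since a ≠ b and a, b ≤ p (m+1) < q; and for a + b either
-- i, j have different parities, in which case a + b ≤ t (m+1) + t m = p (m+1)
-- < q, or the same parity, in which case a + b is even, 0 < a + b < 2q and
-- q is odd.

module Submission where

open import Defs

module ParityFacts where
  open import Data.Nat
  open import Data.Nat.Properties
  open import Data.Nat.Divisibility using (_∣_; divides)
  open import Data.Nat.Primality using (Prime; composite; prime⇒¬composite)
  open import Data.Parity.Base as ℙ using (Parity; 0ℙ; 1ℙ; _⁻¹)
  open import Data.Parity.Properties
    using (⁻¹-selfInverse; suc-homo-⁻¹; +-homo-+; p⁻¹+p≡1ℙ)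
    renaming (+-cancelʳ-≡ to ℙ-+-cancelʳ-≡)
  open import Data.Product using (∃-syntax; _,_)
  open import Data.Empty using (⊥-elim)
  open import Relation.Binary.PropositionalEquality
  open import Relation.Nullary using (¬_; contradiction)

  parity-suc : ∀ n → parity (suc n) ≡ parity n ⁻¹
  parity-suc n = sym (⁻¹-selfInverse (suc-homo-⁻¹ n))

  ≢⇒≡⁻¹ : ∀ {x y : Parity} → x ≢ y → x ≡ y ⁻¹
  ≢⇒≡⁻¹ {0ℙ} {0ℙ} x≢y = ⊥-elim (x≢y refl)
  ≢⇒≡⁻¹ {0ℙ} {1ℙ} _   = refl
  ≢⇒≡⁻¹ {1ℙ} {0ℙ} _   = refl
  ≢⇒≡⁻¹ {1ℙ} {1ℙ} x≢y = ⊥-elim (x≢y refl)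

  +≡1ℙ⇒≡⁻¹ : ∀ x y → x ℙ.+ y ≡ 1ℙ → x ≡ y ⁻¹
  +≡1ℙ⇒≡⁻¹ x y x+y≡1 = ℙ-+-cancelʳ-≡ y x (y ⁻¹) (trans x+y≡1 (sym (p⁻¹+p≡1ℙ y)))

  even⇒double : ∀ {m} → parity m ≡ 0ℙ → ∃[ d ] m ≡ d * 2
  even⇒double {zero}        _ = 0 , refl
  even⇒double {suc (suc m)} e with even⇒double {m} e
  ... | d , refl = suc d , refl

  same-parity-gap : ∀ {i j} → i ≤ j → parity i ≡ parity j →
    ∃[ d ] j ≡ d * 2 + i
  same-parity-gap {i} {j} i≤j same with even⇒double gap-even
    where
    gap-even : parity (j ∸ i) ≡ 0ℙ
    gap-even = ℙ-+-cancelʳ-≡ (parity i) (parity (j ∸ i)) 0ℙ (begin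
      parity (j ∸ i) ℙ.+ parity i ≡⟨ +-homo-+ (j ∸ i) i ⟨
      parity (j ∸ i + i)          ≡⟨ cong parity (m∸n+n≡m i≤j) ⟩
      parity j                    ≡⟨ same ⟨
      parity i                    ∎)
      where open ≡-Reasoning
  ... | d , gap≡d*2 = d , trans (sym (m∸n+n≡m i≤j)) (cong (_+ i) gap≡d*2)

  odd-prime : ∀ {q} → Prime q → 2 < q → parity q ≡ 1ℙ
  odd-prime {q} pr 2<q with parity q in q-parity
  ... | 1ℙ = refl
  ... | 0ℙ =
    let (d , q≡d*2) = even⇒double q-parity
    in contradiction (composite 2<q (divides d q≡d*2)) (prime⇒¬composite pr)

  odd∤even-below-double : ∀ {q x} → parity q ≡ 1ℙ → parity x ≡ 0ℙ →
    0 < x → x < q + q → ¬ q ∣ x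
  odd∤even-below-double _ _ () _ (divides zero refl)
  odd∤even-below-double {q} q-odd x-even _ _ (divides 1 refl) =
    contradiction (trans (sym q-odd) (trans (cong parity (sym (+-identityʳ q))) x-even))
      λ ()
  odd∤even-below-double {q} _ _ _ x<2q (divides (suc (suc k)) refl) =
    <⇒≱ x<2q (+-monoʳ-≤ q (m≤m+n q (k * q)))

module Primes where
  open import Data.Nat
  open import Data.Nat.Properties
  open import Data.Nat.Divisibility
    using (_∣_; divides; ∣⇒≤; ∣1⇒≡1; ∣m+n∣m⇒∣n; ∣-trans; m≤n⇒m!∣n!)
  open import Data.Nat.Primality using (Prime; prime?; prime⇒nonTrivial)
  open import Data.Nat.Primality.Factorisation using (factorise; PrimeFactorisation)
  open import Data.List using ([]; _∷_)
  open import Data.List.Relation.Unary.All using (_∷_)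
  open import Data.Nat.ListAction using (product)
  open import Data.Product using (∃-syntax; _×_; _,_)
  open import Data.Empty using (⊥-elim)
  open import Relation.Binary.PropositionalEquality
  open import Relation.Nullary using (yes; no)
  open import Data.Parity.Base using (1ℙ)
  open ParityFacts using (odd-prime)

  searchPrime-≥ : ∀ f m → m ≤ searchPrime f m
  searchPrime-≥ zero    m = ≤-refl
  searchPrime-≥ (suc f) m with prime? m
  ... | yes _ = ≤-refl
  ... | no  _ = ≤-trans (n≤1+n m) (searchPrime-≥ f (suc m))

  searchPrime-prime : ∀ f m {r} → m ≤ r → r < m + f → Prime r →
    Prime (searchPrime f m)
  searchPrime-prime zero m {r} m≤r r<m+0 _ =
    ⊥-elim (<⇒≱ (subst (r <_) (+-identityʳ m) r<m+0) m≤r)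
  searchPrime-prime (suc f) m {r} m≤r r<m+1+f pr with prime? m
  ... | yes pm = pm
  ... | no ¬pm = searchPrime-prime f (suc m)
      (≤∧≢⇒< m≤r λ m≡r → ¬pm (subst Prime (sym m≡r) pr))
      (subst (r <_) (+-suc m f) r<m+1+f) pr

  prime⇒2≤ : ∀ {r} → Prime r → 2 ≤ r
  prime⇒2≤ {r} pr = nonTrivial⇒n>1 r {{prime⇒nonTrivial pr}}

  prime≤⇒∣! : ∀ {r n} → Prime r → r ≤ n → r ∣ n !
  prime≤⇒∣! {suc r} _ r≤n =
    ∣-trans (divides (r !) (*-comm (suc r) (r !))) (m≤n⇒m!∣n! r≤n)

  -- Euclid: some prime factor of n! + 1 lies in (n, n! + 1].
  euclid : ∀ n → ∃[ r ] n < r × r ≤ n ! + 1 × Prime r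
  euclid n = from (factorise (n ! + 1) {{>-nonZero n!+1>0}})
    where
    n!>0 : 0 < n !
    n!>0 = >-nonZero⁻¹ (n !) {{n !≢0}}
    n!+1>0 : 0 < n ! + 1
    n!+1>0 = ≤-trans n!>0 (m≤m+n (n !) 1)
    from : PrimeFactorisation (n ! + 1) → ∃[ r ] n < r × r ≤ n ! + 1 × Prime r
    from record { factors = [] ; isFactorisation = n!+1≡1 } =
      ⊥-elim (<-irrefl (sym (+-cancelʳ-≡ 1 (n !) 0 n!+1≡1)) n!>0)
    from record { factors = r ∷ rs ; isFactorisation = eq ; factorsPrime = pr ∷ _ } =
      r , n<r , ∣⇒≤ {{>-nonZero n!+1>0}} r∣ , pr
      where
      r∣ : r ∣ n ! + 1
      r∣ = divides (product rs) (trans eq (*-comm r _))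
      n<r : n < r
      n<r with n <? r
      ... | yes n<r = n<r
      ... | no  n≮r = ⊥-elim (<-irrefl r≡1 (prime⇒2≤ pr))
        where
        r≡1 : 1 ≡ r
        r≡1 = sym (∣1⇒≡1 (∣m+n∣m⇒∣n r∣ (prime≤⇒∣! pr (≮⇒≥ n≮r))))

  -- The search for p (k+1) starts at p k + 1 with enough fuel to reach the
  -- prime that Euclid's argument provides.
  p-prime : ∀ k → Prime (p (suc k))
  p-prime k =
    let (r , pk<r , r≤ , pr) = euclid (p k)
    in searchPrime-prime (p k ! + 1) (suc (p k)) pk<r
         (s≤s (≤-trans r≤ (m≤n+m _ (p k)))) pr

  p-increasing : ∀ k → p k < p (suc k)
  p-increasing k = searchPrime-≥ (p k ! + 1) (suc (p k))

  p-mono : ∀ {i j} → i ≤ j → p i ≤ p j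
  p-mono i≤j = p-mono′ (≤⇒≤′ i≤j)
    where
    p-mono′ : ∀ {i j} → i ≤′ j → p i ≤ p j
    p-mono′             ≤′-refl         = ≤-refl
    p-mono′ {j = suc j} (≤′-step i≤′j) = ≤-trans (p-mono′ i≤′j) (<⇒≤ (p-increasing j))

  2<p : ∀ k → 2 < p (suc (suc k))
  2<p k = ≤-<-trans (prime⇒2≤ (p-prime k)) (p-increasing (suc k))

  p-odd : ∀ k → parity (p (suc (suc k))) ≡ 1ℙ
  p-odd k = odd-prime (p-prime (suc k)) (2<p k)

module DoubledSquares where
  open import Data.Nat
  open import Data.Nat.Properties
  open import Data.Nat.Divisibility using (_∣_)
  open import Data.Nat.Primality using (Prime; euclidsLemma)
  open import Data.Integer as ℤ using (+_)
  import Data.Integer.Properties as ℤP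
  open import Data.Sum using (_⊎_; inj₁; inj₂)
  open import Relation.Binary.PropositionalEquality
  open ≡-Reasoning

  squares-distance : ∀ a b → ∣ a * a - b * b ∣ ≡ ∣ a - b ∣ * (a + b)
  squares-distance a b = begin
    ∣ a * a - b * b ∣                 ≡⟨ ∣m+n-m+o∣≡∣n-o∣ (a * b) (a * a) (b * b) ⟨
    ∣ a * b + a * a - a * b + b * b ∣ ≡⟨ cong₂ ∣_-_∣ a[a+b] b[a+b] ⟩
    ∣ a * (a + b) - b * (a + b) ∣     ≡⟨ *-distribʳ-∣-∣ (a + b) a b ⟨
    ∣ a - b ∣ * (a + b)               ∎
    where
    a[a+b] : a * b + a * a ≡ a * (a + b)
    a[a+b] = trans (+-comm (a * b) (a * a)) (sym (*-distribˡ-+ a a b))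
    b[a+b] : a * b + b * b ≡ b * (a + b)
    b[a+b] = trans (cong (_+ b * b) (*-comm a b)) (sym (*-distribˡ-+ b a b))

  prime∣doubled-squares-distance : ∀ {q} a b → Prime q →
    q ∣ ∣ 2 * (a * a) - 2 * (b * b) ∣ → q ∣ 2 ⊎ q ∣ ∣ a - b ∣ ⊎ q ∣ a + b
  prime∣doubled-squares-distance {q} a b pr q∣
    with euclidsLemma 2 (∣ a - b ∣ * (a + b)) pr (subst (q ∣_) factorised q∣)
    where
    factorised : ∣ 2 * (a * a) - 2 * (b * b) ∣ ≡ 2 * (∣ a - b ∣ * (a + b))
    factorised = begin
      ∣ 2 * (a * a) - 2 * (b * b) ∣ ≡⟨ *-distribˡ-∣-∣ 2 (a * a) (b * b) ⟨
      2 * ∣ a * a - b * b ∣         ≡⟨ cong (2 *_) (squares-distance a b) ⟩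
      2 * (∣ a - b ∣ * (a + b))     ∎
  ... | inj₁ q∣2       = inj₁ q∣2
  ... | inj₂ q∣product = inj₂ (euclidsLemma ∣ a - b ∣ (a + b) pr q∣product)

  ∣⊖∣≡∣-∣ : ∀ m n → ℤ.∣ m ℤ.⊖ n ∣ ≡ ∣ m - n ∣
  ∣⊖∣≡∣-∣ zero    zero    = refl
  ∣⊖∣≡∣-∣ zero    (suc n) = refl
  ∣⊖∣≡∣-∣ (suc m) zero    = refl
  ∣⊖∣≡∣-∣ (suc m) (suc n) =
    trans (cong ℤ.∣_∣ (ℤP.[1+m]⊖[1+n]≡m⊖n m n)) (∣⊖∣≡∣-∣ m n)

  doubled-squares-ℤ : ∀ a b →
    ℤ.∣ (+ 2 ℤ.* (+ a ℤ.* + a)) ℤ.- (+ 2 ℤ.* (+ b ℤ.* + b)) ∣ ≡ ∣ 2 * (a * a) - 2 * (b * b) ∣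
  doubled-squares-ℤ a b = begin
    ℤ.∣ (+ 2 ℤ.* (+ a ℤ.* + a)) ℤ.- (+ 2 ℤ.* (+ b ℤ.* + b)) ∣
      ≡⟨ cong ℤ.∣_∣ (cong₂ ℤ._-_ (doubled-square a) (doubled-square b)) ⟩
    ℤ.∣ + (2 * (a * a)) ℤ.- + (2 * (b * b)) ∣
      ≡⟨ cong ℤ.∣_∣ (ℤP.m-n≡m⊖n (2 * (a * a)) (2 * (b * b))) ⟩
    ℤ.∣ (2 * (a * a)) ℤ.⊖ (2 * (b * b)) ∣
      ≡⟨ ∣⊖∣≡∣-∣ (2 * (a * a)) (2 * (b * b)) ⟩
    ∣ 2 * (a * a) - 2 * (b * b) ∣ ∎
    where
    doubled-square : ∀ x → + 2 ℤ.* (+ x ℤ.* + x) ≡ + (2 * (x * x))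
    doubled-square x =
      trans (cong (+ 2 ℤ.*_) (sym (ℤP.pos-* x x))) (sym (ℤP.pos-* 2 (x * x)))

module AlternatingSums where
  open import Data.Nat
  open import Data.Nat.Properties
  open import Data.Nat.Divisibility using (_∣_; >⇒∤)
  open import Data.Parity.Base as ℙ using (0ℙ; 1ℙ; _⁻¹)
  open import Data.Parity.Properties
    using (+-homo-+; p+p≡0ℙ; ⁻¹-injective; ⁻¹-involutive)
    renaming (_≟_ to _≟ℙ_)
  open import Data.Integer as ℤ using (+_)
  import Data.Integer.Properties as ℤP
  open import Data.Integer.Divisibility.Signed as ℤ∣ using (∣⇒∣ᵤ)
  open import Data.Product using (_,_)
  open import Data.Sum using ([_,_]′)
  open import Data.Empty using (⊥-elim)
  open import Relation.Binary.PropositionalEquality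
  open import Relation.Binary.Definitions using (tri<; tri≈; tri>)
  open import Relation.Nullary using (¬_; yes; no)
  open ParityFacts
  open Primes
  open DoubledSquares

  t : ℕ → ℕ
  t zero    = 0
  t (suc n) = p (suc n) ∸ t n

  t≤p : ∀ n → t n ≤ p n
  t≤p zero    = z≤n
  t≤p (suc n) = m∸n≤m (p (suc n)) (t n)

  t≤next-p : ∀ n → t n ≤ p (suc n)
  t≤next-p n = ≤-trans (t≤p n) (<⇒≤ (p-increasing n))

  t-pair-sum : ∀ n → t (suc n) + t n ≡ p (suc n)
  t-pair-sum n = m∸n+n≡m (t≤next-p n)

  -- t is the alternating sum s, read in ℕ (no subtraction truncates).
  s≡t : ∀ n → s n ≡ + t n
  s≡t zero    = refl
  s≡t (suc n) = begin
    + p (suc n) ℤ.- s n   ≡⟨ cong (ℤ._-_ (+ p (suc n))) (s≡t n) ⟩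
    + p (suc n) ℤ.- + t n ≡⟨ ℤP.m-n≡m⊖n (p (suc n)) (t n) ⟩
    p (suc n) ℤ.⊖ t n     ≡⟨ ℤP.⊖-≥ (t≤next-p n) ⟩
    + t (suc n)           ∎
    where open ≡-Reasoning

  -- t (n+2) − t n = p (n+2) − p (n+1) > 0.
  t-two-step : ∀ n → t n < t (suc (suc n))
  t-two-step n = m+n≤o⇒m≤o∸n (suc (t n)) (begin
    suc (t n + t (suc n)) ≡⟨ cong suc (+-comm (t n) (t (suc n))) ⟩
    suc (t (suc n) + t n) ≡⟨ cong suc (t-pair-sum n) ⟩
    suc (p (suc n))       ≤⟨ p-increasing (suc n) ⟩
    p (suc (suc n))       ∎)
    where open ≤-Reasoning

  t-grows : ∀ i d → t i + d ≤ t (d * 2 + i)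
  t-grows i zero    = ≤-reflexive (+-identityʳ (t i))
  t-grows i (suc d) = begin
    t i + suc d         ≡⟨ +-suc (t i) d ⟩
    suc (t i + d)       ≤⟨ s≤s (t-grows i d) ⟩
    suc (t (d * 2 + i)) ≤⟨ t-two-step (d * 2 + i) ⟩
    t (suc d * 2 + i)   ∎
    where open ≤-Reasoning

  t-mono-class : ∀ {i j} → i ≤ j → parity i ≡ parity j → t i ≤ t j
  t-mono-class {i} i≤j same with same-parity-gap i≤j same
  ... | d , refl = ≤-trans (m≤m+n (t i) d) (t-grows i d)

  t-strict-class : ∀ {i j} → i < j → parity i ≡ parity j → t i < t j
  t-strict-class {i} i<j same with same-parity-gap (<⇒≤ i<j) same
  ... | zero  , refl = ⊥-elim (<-irrefl refl i<j)
  ... | suc d , refl = <-≤-trans (m<m+n (t i) z<s) (t-grows i (suc d))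

  -- t (k+1) has the parity of k: t 1 = 2, and t (k+2) + t (k+1) is an odd prime.
  parity-t : ∀ k → parity (t (suc k)) ≡ parity k
  parity-t zero    = refl
  parity-t (suc k) = begin
    parity (t (suc (suc k))) ≡⟨ +≡1ℙ⇒≡⁻¹ _ _ pair-odd ⟩
    parity (t (suc k)) ⁻¹    ≡⟨ cong _⁻¹ (parity-t k) ⟩
    parity k ⁻¹              ≡⟨ parity-suc k ⟨
    parity (suc k)           ∎
    where
    open ≡-Reasoning
    pair-odd : parity (t (suc (suc k))) ℙ.+ parity (t (suc k)) ≡ 1ℙ
    pair-odd = begin
      parity (t (suc (suc k))) ℙ.+ parity (t (suc k)) ≡⟨ +-homo-+ (t (suc (suc k))) (t (suc k)) ⟨
      parity (t (suc (suc k)) + t (suc k))            ≡⟨ cong parity (t-pair-sum (suc k)) ⟩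
      parity (p (suc (suc k)))                        ≡⟨ p-odd k ⟩
      1ℙ                                              ∎

  t-value-determines-parity : ∀ {i j} → t (suc i) ≡ t (suc j) →
    parity (suc i) ≡ parity (suc j)
  t-value-determines-parity {i} {j} ti≡tj = begin
    parity (suc i)         ≡⟨ parity-suc i ⟩
    parity i ⁻¹            ≡⟨ cong _⁻¹ (parity-t i) ⟨
    parity (t (suc i)) ⁻¹  ≡⟨ cong (λ x → parity x ⁻¹) ti≡tj ⟩
    parity (t (suc j)) ⁻¹  ≡⟨ cong _⁻¹ (parity-t j) ⟩
    parity j ⁻¹            ≡⟨ parity-suc j ⟨
    parity (suc j)         ∎
    where open ≡-Reasoning

  -- t is injective on positive indices: equal values give indices of equal
  -- parity, on which t is strictly monotone.
  t-injective : ∀ {i j} → 1 ≤ i → 1 ≤ j → t i ≡ t j → i ≡ j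
  t-injective {suc i} {suc j} _ _ ti≡tj with <-cmp (suc i) (suc j)
  ... | tri< i<j _ _ =
    ⊥-elim (<-irrefl ti≡tj (t-strict-class i<j (t-value-determines-parity {i} {j} ti≡tj)))
  ... | tri≈ _ i≡j _ = i≡j
  ... | tri> _ _ j<i =
    ⊥-elim (<-irrefl (sym ti≡tj) (t-strict-class j<i (sym (t-value-determines-parity {i} {j} ti≡tj))))

  -- Up to m+1, an index outside the parity class of m+1 lies in the class
  -- of m, so its t-value is at most t m.
  t-bound-other-class : ∀ {m x} → x ≤ suc m → parity x ≢ parity (suc m) → t x ≤ t m
  t-bound-other-class {m} {x} x≤1+m x-other =
    t-mono-class (≤-pred (≤∧≢⇒< x≤1+m λ x≡1+m → x-other (cong parity x≡1+m))) x-class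
    where
    x-class : parity x ≡ parity m
    x-class = trans (≢⇒≡⁻¹ x-other)
      (trans (cong _⁻¹ (parity-suc m)) (⁻¹-involutive (parity m)))

  -- Two indices up to m+1 from opposite parity classes:
  -- t x + t y ≤ t (m+1) + t m = p (m+1).
  opposite-classes-sum-bound : ∀ {m x y} → x ≤ suc m → y ≤ suc m →
    parity x ≡ parity (suc m) → parity y ≢ parity (suc m) → t x + t y ≤ p (suc m)
  opposite-classes-sum-bound {m} x≤1+m y≤1+m x-class y-other =
    subst (_ ≤_) (t-pair-sum m)
      (+-mono-≤ (t-mono-class x≤1+m x-class) (t-bound-other-class y≤1+m y-other))

  different-parity-sum-bound : ∀ {m i j} → i ≤ suc m → j ≤ suc m →
    parity i ≢ parity j → t i + t j ≤ p (suc m)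
  different-parity-sum-bound {m} {i} {j} i≤1+m j≤1+m i≢j
    with parity i ≟ℙ parity (suc m)
  ... | yes i-class = opposite-classes-sum-bound i≤1+m j≤1+m i-class
    λ j-class → i≢j (trans i-class (sym j-class))
  ... | no i-other = subst (_≤ p (suc m)) (+-comm (t j) (t i))
    (opposite-classes-sum-bound j≤1+m i≤1+m j-class i-other)
    where
    -- both parities differ from that of i
    j-class : parity j ≡ parity (suc m)
    j-class = trans (≢⇒≡⁻¹ λ e → i≢j (sym e)) (sym (≢⇒≡⁻¹ λ e → i-other (sym e)))

  -- For positive indices of equal parity, the t-values have equal parity, so
  -- their sum is even.
  same-parity-sum-even : ∀ {i j} → parity (suc i) ≡ parity (suc j) →
    parity (t (suc i) + t (suc j)) ≡ 0ℙ
  same-parity-sum-even {i} {j} same = begin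
    parity (t (suc i) + t (suc j))              ≡⟨ +-homo-+ (t (suc i)) (t (suc j)) ⟩
    parity (t (suc i)) ℙ.+ parity (t (suc j))   ≡⟨ cong₂ ℙ._+_ (parity-t i) (parity-t j) ⟩
    parity i ℙ.+ parity j                       ≡⟨ cong (parity i ℙ.+_) i≡j-parity ⟨
    parity i ℙ.+ parity i                       ≡⟨ p+p≡0ℙ (parity i) ⟩
    0ℙ                                          ∎
    where
    open ≡-Reasoning
    i≡j-parity : parity i ≡ parity j
    i≡j-parity = ⁻¹-injective (trans (sym (parity-suc i)) (trans same (parity-suc j)))

  t<next-prime : ∀ {m k} → k ≤ suc m → t k < p (suc (suc m))
  t<next-prime {m} {k} k≤1+m =
    ≤-<-trans (≤-trans (t≤p k) (p-mono k≤1+m)) (p-increasing (suc m))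

  no-collision : ∀ m {i j} → 1 ≤ i → i ≤ suc m → 1 ≤ j → j ≤ suc m → i ≢ j →
    ¬ p (suc (suc m)) ∣ ∣ 2 * (t i * t i) - 2 * (t j * t j) ∣
  no-collision m {suc i} {suc j} 1≤i i≤1+m 1≤j j≤1+m i≢j q∣ =
    [ q∤2 , [ q∤∣a-b∣ , q∤a+b ]′ ]′ (prime∣doubled-squares-distance a b (p-prime (suc m)) q∣)
    where
    q = p (suc (suc m))
    a = t (suc i)
    b = t (suc j)
    a<q = t<next-prime i≤1+m
    b<q = t<next-prime j≤1+m
    ∣a-b∣≢0 : ∣ a - b ∣ ≢ 0
    ∣a-b∣≢0 ∣a-b∣≡0 = i≢j (t-injective 1≤i 1≤j (∣m-n∣≡0⇒m≡n ∣a-b∣≡0))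
    a+b>0 : 0 < a + b
    a+b>0 = <-≤-trans (n≢0⇒n>0 ∣a-b∣≢0) (≤-trans (∣m-n∣≤m⊔n a b) (m⊔n≤m+n a b))

    q∤2 : ¬ q ∣ 2
    q∤2 = >⇒∤ (2<p m)
    -- 0 < ∣ a − b ∣ ≤ max a b < q
    q∤∣a-b∣ : ¬ q ∣ ∣ a - b ∣
    q∤∣a-b∣ = >⇒∤ {{≢-nonZero ∣a-b∣≢0}} (≤-<-trans (∣m-n∣≤m⊔n a b) (⊔-lub a<q b<q))
    -- a + b is even and below 2q, or at most p (m+1) < q
    q∤a+b : ¬ q ∣ a + b
    q∤a+b with parity (suc i) ≟ℙ parity (suc j)
    ... | yes same = odd∤even-below-double (p-odd m) (same-parity-sum-even {i} {j} same)
      a+b>0 (+-mono-< a<q b<q)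
    ... | no different = >⇒∤ {{>-nonZero a+b>0}}
      (≤-<-trans (different-parity-sum-bound i≤1+m j≤1+m different) (p-increasing (suc m)))

  divisibility-in-ℕ : ∀ {q} i j →
    (+ q) ℤ∣.∣ (+ 2 ℤ.* (s i ℤ.* s i)) ℤ.- (+ 2 ℤ.* (s j ℤ.* s j)) →
    q ∣ ∣ 2 * (t i * t i) - 2 * (t j * t j) ∣
  divisibility-in-ℕ {q} i j q∣ = subst (q ∣_) (doubled-squares-ℤ (t i) (t j)) (∣⇒∣ᵤ
    (subst₂ (λ x y → (+ q) ℤ∣.∣ (+ 2 ℤ.* (x ℤ.* x)) ℤ.- (+ 2 ℤ.* (y ℤ.* y))) (s≡t i) (s≡t j) q∣))

open import Data.Nat using (ℕ; _≤_; _<_)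
open import Data.Integer using (ℤ; +_; _*_; _-_)
open import Data.Integer.Divisibility.Signed using (_∣_)
open import Relation.Binary.PropositionalEquality using (_≡_)
open import Relation.Nullary using (¬_)

open import Data.Nat using (suc)
open import Data.Nat.Properties using (+-comm)
open import Relation.Binary.PropositionalEquality using (subst)
open AlternatingSums using (divisibility-in-ℕ; no-collision)

theorem1p5 : (n : ℕ) → 1 ≤ n → (i j : ℕ) → 1 ≤ i → i ≤ n → 1 ≤ j → j ≤ n →
    ¬ (i ≡ j) → ¬ ((+ p (Data.Nat._+_ n 1)) ∣ ((+ 2 * (s i * s i)) - (+ 2 * (s j * s j))))
theorem1p5 (suc m) _ i j 1≤i i≤n 1≤j j≤n i≢j q∣ =
  no-collision m 1≤i i≤n 1≤j j≤n i≢j (divisibility-in-ℕ i j (subst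
    (λ k → (+ p k) ∣ ((+ 2 * (s i * s i)) - (+ 2 * (s j * s j))))
    (+-comm (suc m) 1) q∣))
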